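{- For every positive integer $n$ there are infinitely many (finite simple) graphs $G$ for which $\operatorname{Dist}_f(G)> n\cdot \operatorname{Dist}(G)$.
   Context: A $d$-distinguishing coloring of $G$ is an assignment of colors from a set of $d$ colors to the vertices such that the only automorphism mapping each color class to itself is the identity. $\operatorname{Dist}(G)$ is the least $d$ for which a $d$-distinguishing coloring exists. The paint cost $\rho^d(G)$ is the minimum of $|V(G)\setminus T|$ over all $d$-distinguishing colorings and all their color classes $T$. A determining set is a set $S\subseteq V(G)$ such that only the identity automorphism fixes every vertex of $S$; $\det(G)$ is its minimum size. The frugal distinguishing number $\operatorname{Dist}_f(G)$ is the smallest $d$ for which $\rho^d(G)=\det(G)$. -}

module Defs where

open import Data.Nat using (ℕ; _<_)
open import Data.Bool using (Bool; false)
open import Data.Fin using (Fin)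
open import Data.Fin.Properties using (_≟_)
open import Data.Fin.Subset using (Subset; _∈_; ∣_∣)
open import Data.List using (length; filter)
open import Data.Product using (Σ; _×_; ∃)
open import Relation.Nullary using (¬_; ¬?)
open import Relation.Binary.PropositionalEquality using (_≡_; _≢_)
import Data.List.Base as L
open import Data.Fin.Base using (Fin)

record Graph (k : ℕ) : Set where
  field
    adj    : Fin k → Fin k → Bool
    sym    : ∀ u v → adj u v ≡ adj v u
    irrefl : ∀ v → adj v v ≡ false
open Graph public

record Aut {k : ℕ} (G : Graph k) : Set where
  field
    to       : Fin k → Fin k
    from     : Fin k → Fin k
    to-from  : ∀ v → to (from v) ≡ v
    from-to  : ∀ v → from (to v) ≡ v
    preserve : ∀ u v → adj G (to u) (to v) ≡ adj G u v
open Aut public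

IsIdentity : ∀ {k} {G : Graph k} → Aut G → Set
IsIdentity σ = ∀ v → to σ v ≡ v

Distinguishing : ∀ {k} (G : Graph k) (d : ℕ) → (Fin k → Fin d) → Set
Distinguishing G d c =
  (σ : Aut G) → (∀ v → c (to σ v) ≡ c v) → IsIdentity σ

Least : (ℕ → Set) → ℕ → Set
Least P d = P d × (∀ d′ → d′ < d → ¬ P d′)

IsMin : (ℕ → Set) → ℕ → Set
IsMin P m = P m × (∀ m′ → P m′ → ¬ (m′ < m))

IsDist : ∀ {k} → Graph k → ℕ → Set
IsDist {k} G = Least (λ d → Σ (Fin k → Fin d) (Distinguishing G d))

classComplementSize : ∀ {k d} → (Fin k → Fin d) → Fin d → ℕ
classComplementSize {k} c i = length (filter (λ v → ¬? (c v ≟ i)) (L.allFin k))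

IsPaintCost : ∀ {k} → Graph k → ℕ → ℕ → Set
IsPaintCost {k} G d = IsMin (λ m →
  Σ (Fin k → Fin d) λ c → Distinguishing G d c × ∃ λ (i : Fin d) → classComplementSize c i ≡ m)

Determining : ∀ {k} (G : Graph k) → Subset k → Set
Determining G S = (σ : Aut G) → (∀ v → v ∈ S → to σ v ≡ v) → IsIdentity σ

IsDet : ∀ {k} → Graph k → ℕ → Set
IsDet {k} G = IsMin (λ m → Σ (Subset k) λ S → Determining G S × ∣ S ∣ ≡ m)

IsDistf : ∀ {k} → Graph k → ℕ → Set
IsDistf G = Least (λ d → ∃ λ m → IsPaintCost G d m × IsDet G m)

-- The graphs are the perfect matchings mK₂ with m = s² edges.  Every
-- determining set, and the complement of every colour class of a
-- distinguishing colouring, must meet each edge, so det = ρ = m.  A colouring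
-- attaining ρ = m uses one colour i on exactly one end of every edge; if two
-- edges also agreed on the colour of their other ends, exchanging them would be
-- a colour-preserving automorphism, so the m other ends need m colours besides
-- i and Dist_f = m + 1.  Colouring the ends of edge j by the two base-s digits
-- of j, drawn from disjoint palettes, distinguishes with 2s colours, and
-- n · 2s < s² + 1 once s > 2n.  Constructively, Dist exists as a least number
-- because being distinguishing is decidable for finite graphs.
module Submission where

open import Defs hiding (sym)
open import Data.Nat using (ℕ; _<_; _*_; zero; suc; _+_; _≤_; s≤s; s≤s⁻¹; s<s⁻¹; z≤n; NonZero)
open import Data.Product using (Σ; _×_; ∃; _,_; proj₁; proj₂; ∃₂; uncurry)

open import Data.Bool using (Bool; true; false; not; _xor_)
import Data.Bool as Bool
open import Data.Bool.Properties using (not-involutive; not-distribˡ-xor; xor-assoc; xor-identityʳ)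
open import Data.Fin as Fin
  using (Fin; zero; suc; _↑ˡ_; _↑ʳ_; splitAt; remQuot; quotient; remainder; combine;
         finToFun; funToFin)
open import Data.Fin.Permutation using (Permutation′; _⟨$⟩ʳ_; _⟨$⟩ˡ_; inverseˡ; inverseʳ; transpose)
import Data.Fin.Permutation as Perm
import Data.Fin.Permutation.Components as PC
open import Data.Fin.Properties
  using (_≟_; all?; any?; pigeonhole; suc-injective; ↑ˡ-injective; ↑ʳ-injective;
         splitAt-↑ˡ; splitAt-↑ʳ; join-splitAt; combine-remQuot; finToFun-funToFin; <⇒≢)
open import Data.Fin.Subset using (Subset; inside; outside; _∈_; _⊆_; ∣_∣; _∪_; _∩_; ⊤; ⊥)
open import Data.Fin.Subset.Properties
  using (_∈?_; ∈⊤; ∣⊤∣≡n; ∣⊥∣≡0; p⊆q⇒∣p∣≤∣q∣; x∈p∪q⁺; x∈p∩q⁺; x∈p⇒∣p-x∣<∣p∣)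
import Data.List as List
open import Data.Nat.Properties
  using (≤-refl; ≤-trans; ≤⇒≯; <⇒≱; ≤-antisym; ≤-<-trans; ≮⇒≥; ≰⇒>; m<1+n⇒m<n∨m≡n;
         m≤m+n; m≤n+m; +-suc; +-identityʳ; +-mono-≤-<; m<n⇒m<1+n;
         *-monoʳ-≤; *-monoˡ-<; *-distribˡ-+; *-distribʳ-+; m≤m*n; module ≤-Reasoning)
open import Data.Product.Properties using (≡-dec; ×-≡,≡→≡)
open import Data.Sum using (_⊎_; inj₁; inj₂; [_,_]′)
import Data.Sum as Sum
open import Data.Vec as Vec using ([]; _∷_; _++_; tabulate)
open import Data.Vec.Properties using (lookup∘tabulate; lookup-++ˡ; lookup-++ʳ; []=⇒lookup; lookup⇒[]=)
open import Function using (_∘_)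
open import Relation.Binary.PropositionalEquality
  using (_≡_; _≢_; _≗_; refl; sym; trans; cong; cong₂; subst; module ≡-Reasoning)
open import Relation.Nullary using (Dec; yes; no; does; ¬_; ¬?; contradiction)
open import Relation.Nullary.Decidable using (map′; _→-dec_; dec-true; dec-false; does-≡)
open import Relation.Unary using (Decidable)

-- Deciding distinguishability

module _ {P : ℕ → Set} (P? : Decidable P) where

  least-or-none-below : ∀ n → Σ ℕ (Least P) ⊎ (∀ d → d < n → ¬ P d)
  least-or-none-below zero = inj₂ λ _ ()
  least-or-none-below (suc n) with least-or-none-below n
  ... | inj₁ least = inj₁ least
  ... | inj₂ none with P? n
  ...   | yes p = inj₁ (n , p , none)
  ...   | no ¬p = inj₂ λ d d<1+n → [ none d , (λ { refl → ¬p }) ]′ (m<1+n⇒m<n∨m≡n d<1+n)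

  least-≤ : ∀ {n} → P n → Σ ℕ λ a → Least P a × a ≤ n
  least-≤ {n} p with least-or-none-below (suc n)
  ... | inj₁ (a , least) = a , least , ≮⇒≥ (λ n<a → proj₂ least n n<a p)
  ... | inj₂ none = contradiction p (none n ≤-refl)

module _ {m n : ℕ} {P : (Fin m → Fin n) → Set}
         (resp : ∀ {f g} → f ≗ g → P f → P g) (P? : ∀ f → Dec (P f)) where

  all-functions? : Dec (∀ f → P f)
  all-functions? = map′ (λ all f → resp (finToFun-funToFin f) (all (funToFin f)))
                        (λ all k → all (finToFun k))
                        (all? (P? ∘ finToFun))

  any-function? : Dec (∃ P)
  any-function? = map′ (λ (k , p) → finToFun k , p)
                       (λ (f , p) → funToFin f , resp (sym ∘ finToFun-funToFin f) p)
                       (any? (P? ∘ finToFun))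

module _ {k : ℕ} (G : Graph k) where

  -- Distinguishing with the automorphism unpacked into its two functions,
  -- so that deciding it reduces to quantifying over functions.
  TrivialIfColourAut : ∀ {d} → (Fin k → Fin d) → (Fin k → Fin k) → (Fin k → Fin k) → Set
  TrivialIfColourAut c t f =
    (∀ v → t (f v) ≡ v) → (∀ v → f (t v) ≡ v) → (∀ u v → adj G (t u) (t v) ≡ adj G u v) →
    (∀ v → c (t v) ≡ c v) → ∀ v → t v ≡ v

  trivialIfColourAut? : ∀ {d} (c : Fin k → Fin d) t f → Dec (TrivialIfColourAut c t f)
  trivialIfColourAut? c t f =
    all? (λ v → t (f v) ≟ v) →-dec all? (λ v → f (t v) ≟ v) →-dec
    all? (λ u → all? (λ v → adj G (t u) (t v) Bool.≟ adj G u v)) →-dec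
    all? (λ v → c (t v) ≟ c v) →-dec all? (λ v → t v ≟ v)

  trivialIfColourAut-resp : ∀ {d} (c : Fin k → Fin d) {t t′ f f′} → t ≗ t′ → f ≗ f′ →
    TrivialIfColourAut c t f → TrivialIfColourAut c t′ f′
  trivialIfColourAut-resp c {t} {t′} {f} {f′} t≗t′ f≗f′ triv tf ft pres col v =
    trans (sym (t≗t′ v)) (triv
      (λ v → trans (t≗t′ (f v)) (trans (cong t′ (f≗f′ v)) (tf v)))
      (λ v → trans (f≗f′ (t v)) (trans (cong f′ (t≗t′ v)) (ft v)))
      (λ u v → trans (cong₂ (adj G) (t≗t′ u) (t≗t′ v)) (pres u v))
      (λ v → trans (cong c (t≗t′ v)) (col v))
      v)

  distinguishing? : ∀ {d} (c : Fin k → Fin d) → Dec (Distinguishing G d c)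
  distinguishing? c =
    map′ (λ triv σ → triv (to σ) (from σ) (to-from σ) (from-to σ) (preserve σ))
         (λ dist t f tf ft pres →
           dist record { to = t ; from = f ; to-from = tf ; from-to = ft ; preserve = pres })
         (all-functions? (λ t≗t′ triv f → trivialIfColourAut-resp c t≗t′ (λ _ → refl) (triv f))
           (λ t → all-functions? (trivialIfColourAut-resp c (λ _ → refl)) (trivialIfColourAut? c t)))

  distinguishing-resp : ∀ {d} {c c′ : Fin k → Fin d} → c ≗ c′ → Distinguishing G d c → Distinguishing G d c′
  distinguishing-resp c≗c′ dist σ col = dist σ λ v → trans (c≗c′ (to σ v)) (trans (col v) (sym (c≗c′ v)))

  IsDist-≤ : ∀ {d} → Σ (Fin k → Fin d) (Distinguishing G d) → Σ ℕ λ a → IsDist G a × a ≤ d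
  IsDist-≤ = least-≤ (λ d → any-function? distinguishing-resp distinguishing?)

-- Colour classes and determining sets

module _ {k d : ℕ} (c : Fin k → Fin d) (i : Fin d) where

  outsideClass : Subset k
  outsideClass = tabulate (λ v → does (¬? (c v ≟ i)))

  outsideClass⁺ : ∀ {v} → c v ≢ i → v ∈ outsideClass
  outsideClass⁺ {v} cv≢i = lookup⇒[]= v outsideClass
    (trans (lookup∘tabulate _ v) (cong not (dec-false (c v ≟ i) cv≢i)))

  outsideClass⁻ : ∀ {v} → v ∈ outsideClass → c v ≢ i
  outsideClass⁻ {v} v∈ cv≡i with trans (sym (lookup∘tabulate _ v)) ([]=⇒lookup v∈)
  ... | eq rewrite dec-true (c v ≟ i) cv≡i = contradiction eq λ ()

length-filter-tabulate : ∀ {n} {A : Set} {P : A → Set} (P? : Decidable P) (g : Fin n → A) →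
  List.length (List.filter P? (List.tabulate g)) ≡ ∣ tabulate (does ∘ P? ∘ g) ∣
length-filter-tabulate {zero} P? g = refl
length-filter-tabulate {suc n} P? g with does (P? (g zero))
... | true = cong suc (length-filter-tabulate P? (g ∘ suc))
... | false = length-filter-tabulate P? (g ∘ suc)

classComplementSize≡∣outsideClass∣ : ∀ {k d} (c : Fin k → Fin d) i → classComplementSize c i ≡ ∣ outsideClass c i ∣
classComplementSize≡∣outsideClass∣ c i = length-filter-tabulate (λ v → ¬? (c v ≟ i)) (λ v → v)

outsideClass-determining : ∀ {k d} (G : Graph k) {c : Fin k → Fin d} → Distinguishing G d c →
  ∀ i → Determining G (outsideClass c i)
outsideClass-determining G {c} dist i σ fixes = dist σ preservesColours
  where
  -- σ fixes everything outside the class i, so by injectivity it also maps the class into itself.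
  preservesColours : ∀ v → c (to σ v) ≡ c v
  preservesColours v with c v ≟ i | c (to σ v) ≟ i
  ... | no cv≢i | _ = cong c (fixes v (outsideClass⁺ c i cv≢i))
  ... | yes cv≡i | yes cσv≡i = trans cσv≡i (sym cv≡i)
  ... | yes cv≡i | no cσv≢i = contradiction (trans (cong c σv≡v) cv≡i) cσv≢i
    where
    σv≡v : to σ v ≡ v
    σv≡v = trans (sym (from-to σ (to σ v)))
      (trans (cong (from σ) (fixes (to σ v) (outsideClass⁺ c i cσv≢i))) (from-to σ v))

∣p++q∣≡∣p∣+∣q∣ : ∀ {m n} (p : Subset m) (q : Subset n) → ∣ p ++ q ∣ ≡ ∣ p ∣ + ∣ q ∣
∣p++q∣≡∣p∣+∣q∣ [] q = refl
∣p++q∣≡∣p∣+∣q∣ (inside ∷ p) q = cong suc (∣p++q∣≡∣p∣+∣q∣ p q)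
∣p++q∣≡∣p∣+∣q∣ (outside ∷ p) q = ∣p++q∣≡∣p∣+∣q∣ p q

∣p∪q∣+∣p∩q∣≡∣p∣+∣q∣ : ∀ {n} (p q : Subset n) → ∣ p ∪ q ∣ + ∣ p ∩ q ∣ ≡ ∣ p ∣ + ∣ q ∣
∣p∪q∣+∣p∩q∣≡∣p∣+∣q∣ [] [] = refl
∣p∪q∣+∣p∩q∣≡∣p∣+∣q∣ (inside ∷ p) (inside ∷ q) =
  cong suc (trans (+-suc _ _) (trans (cong suc (∣p∪q∣+∣p∩q∣≡∣p∣+∣q∣ p q)) (sym (+-suc _ _))))
∣p∪q∣+∣p∩q∣≡∣p∣+∣q∣ (inside ∷ p) (outside ∷ q) = cong suc (∣p∪q∣+∣p∩q∣≡∣p∣+∣q∣ p q)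
∣p∪q∣+∣p∩q∣≡∣p∣+∣q∣ (outside ∷ p) (inside ∷ q) =
  trans (cong suc (∣p∪q∣+∣p∩q∣≡∣p∣+∣q∣ p q)) (sym (+-suc _ _))
∣p∪q∣+∣p∩q∣≡∣p∣+∣q∣ (outside ∷ p) (outside ∷ q) = ∣p∪q∣+∣p∩q∣≡∣p∣+∣q∣ p q

module _ {m n : ℕ} (p : Subset m) (q : Subset n) where

  ∈-++⁺ˡ : ∀ {i} → i ∈ p → i ↑ˡ n ∈ p ++ q
  ∈-++⁺ˡ {i} i∈p = lookup⇒[]= (i ↑ˡ n) (p ++ q) (trans (lookup-++ˡ p q i) ([]=⇒lookup i∈p))

  ∈-++⁻ˡ : ∀ {i} → i ↑ˡ n ∈ p ++ q → i ∈ p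
  ∈-++⁻ˡ {i} i∈pq = lookup⇒[]= i p (trans (sym (lookup-++ˡ p q i)) ([]=⇒lookup i∈pq))

  ∈-++⁻ʳ : ∀ {i} → m ↑ʳ i ∈ p ++ q → i ∈ q
  ∈-++⁻ʳ {i} i∈pq = lookup⇒[]= i q (trans (sym (lookup-++ʳ p q i)) ([]=⇒lookup i∈pq))

∣p++q∣≡∣p∪q∣+∣p∩q∣ : ∀ {n} (p q : Subset n) → ∣ p ++ q ∣ ≡ ∣ p ∪ q ∣ + ∣ p ∩ q ∣
∣p++q∣≡∣p∪q∣+∣p∩q∣ p q = trans (∣p++q∣≡∣p∣+∣q∣ p q) (sym (∣p∪q∣+∣p∩q∣≡∣p∣+∣q∣ p q))

Covers : ∀ {m} → Subset (m + m) → Set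
Covers {m} S = ∀ j → j ↑ˡ m ∈ S ⊎ m ↑ʳ j ∈ S

covers⇒m≤∣p∪q∣ : ∀ {m} (p q : Subset m) → Covers (p ++ q) → m ≤ ∣ p ∪ q ∣
covers⇒m≤∣p∪q∣ {m} p q covers = subst (_≤ ∣ p ∪ q ∣) (∣⊤∣≡n m) (p⊆q⇒∣p∣≤∣q∣ ⊤⊆p∪q)
  where
  ⊤⊆p∪q : ⊤ ⊆ p ∪ q
  ⊤⊆p∪q {j} _ = x∈p∪q⁺ (Sum.map (∈-++⁻ˡ p q) (∈-++⁻ʳ p q) (covers j))

covers⇒m≤∣S∣ : ∀ {m} (S : Subset (m + m)) → Covers S → m ≤ ∣ S ∣
covers⇒m≤∣S∣ {m} S covers with Vec.splitAt m S
... | p , q , refl = begin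
  m                     ≤⟨ covers⇒m≤∣p∪q∣ p q covers ⟩
  ∣ p ∪ q ∣             ≤⟨ m≤m+n _ _ ⟩
  ∣ p ∪ q ∣ + ∣ p ∩ q ∣ ≡⟨ ∣p++q∣≡∣p∪q∣+∣p∩q∣ p q ⟨
  ∣ p ++ q ∣            ∎
  where open ≤-Reasoning

covers⇒m<∣S∣ : ∀ {m} (S : Subset (m + m)) → Covers S → ∀ j → j ↑ˡ m ∈ S → m ↑ʳ j ∈ S → m < ∣ S ∣
covers⇒m<∣S∣ {m} S covers j l r with Vec.splitAt m S
... | p , q , refl = begin-strict
  m                     ≡⟨ +-identityʳ m ⟨
  m + 0                 <⟨ +-mono-≤-< (covers⇒m≤∣p∪q∣ p q covers) 0<∣p∩q∣ ⟩
  ∣ p ∪ q ∣ + ∣ p ∩ q ∣ ≡⟨ ∣p++q∣≡∣p∪q∣+∣p∩q∣ p q ⟨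
  ∣ p ++ q ∣            ∎
  where
  open ≤-Reasoning
  0<∣p∩q∣ : 0 < ∣ p ∩ q ∣
  0<∣p∩q∣ = ≤-<-trans z≤n (x∈p⇒∣p-x∣<∣p∣ (x∈p∩q⁺ (∈-++⁻ˡ p q l , ∈-++⁻ʳ p q r)))

transpose-invariant : ∀ {n} {A : Set} (f : Fin n → A) {i j} → f i ≡ f j → ∀ k → f (PC.transpose i j k) ≡ f k
transpose-invariant f {i} {j} fi≡fj k with k ≟ i
... | yes refl = sym fi≡fj
... | no _ with k ≟ j
...   | yes refl = fi≡fj
...   | no _ = refl

transpose-sends : ∀ {n} (i j : Fin n) → PC.transpose i j i ≡ j
transpose-sends i j with i ≟ i
... | yes _ = refl
... | no i≢i = contradiction refl i≢i

xor-cancelʳ : ∀ x y → (x xor y) xor y ≡ x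
xor-cancelʳ false false = refl
xor-cancelʳ false true = refl
xor-cancelʳ true false = refl
xor-cancelʳ true true = refl

↑ˡ≢↑ʳ : ∀ {m n} (i : Fin m) (j : Fin n) → i ↑ˡ n ≢ m ↑ʳ j
↑ˡ≢↑ʳ {m} {n} i j eq with trans (sym (splitAt-↑ˡ m i n)) (trans (cong (splitAt m) eq) (splitAt-↑ʳ m n j))
... | ()

remQuot-injective : ∀ {m} n {i j : Fin (m * n)} → remQuot {m} n i ≡ remQuot n j → i ≡ j
remQuot-injective {m} n {i} {j} eq =
  trans (sym (combine-remQuot {m} n i)) (trans (cong (uncurry combine) eq) (combine-remQuot {m} n j))

-- The perfect matching

module Matching (m : ℕ) where

  -- (j , b) is the end on side b of the j-th edge.
  End : Set
  End = Fin m × Bool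

  _≟ᴱ_ : (e e′ : End) → Dec (e ≡ e′)
  _≟ᴱ_ = ≡-dec _≟_ Bool._≟_

  partner : End → End
  partner (j , b) = j , not b

  partner-involutive : ∀ e → partner (partner e) ≡ e
  partner-involutive (j , b) = cong (j ,_) (not-involutive b)

  partner-swap : ∀ {e e′} → e ≡ partner e′ → e′ ≡ partner e
  partner-swap {e′ = e′} refl = sym (partner-involutive e′)

  partner-≢ : ∀ e → e ≢ partner e
  partner-≢ (j , false) ()
  partner-≢ (j , true) ()

  vertex : End → Fin (m + m)
  vertex (j , false) = j ↑ˡ m
  vertex (j , true) = m ↑ʳ j

  end : Fin (m + m) → End
  end v = [ (_, false) , (_, true) ]′ (splitAt m v)

  end-vertex : ∀ e → end (vertex e) ≡ e
  end-vertex (j , false) rewrite splitAt-↑ˡ m j m = refl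
  end-vertex (j , true) rewrite splitAt-↑ʳ m m j = refl

  vertex-end : ∀ v → vertex (end v) ≡ v
  vertex-end v with splitAt m v | join-splitAt m m v
  ... | inj₁ j | eq = eq
  ... | inj₂ j | eq = eq

  vertex-injective : ∀ {e e′} → vertex e ≡ vertex e′ → e ≡ e′
  vertex-injective {e} {e′} eq = trans (sym (end-vertex e)) (trans (cong end eq) (end-vertex e′))

  on-ends : ∀ {P : Fin (m + m) → Set} → (∀ e → P (vertex e)) → ∀ v → P v
  on-ends {P} P-ends v = subst P (vertex-end v) (P-ends (end v))

  matching : Graph (m + m)
  matching = record
    { adj = λ u v → does (end u ≟ᴱ partner (end v))
    ; sym = λ u v → does-≡ (end u ≟ᴱ partner (end v)) (map′ partner-swap partner-swap (end v ≟ᴱ partner (end u)))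
    ; irrefl = λ v → dec-false (end v ≟ᴱ partner (end v)) (partner-≢ (end v))
    }

  adjacent⇒partner : ∀ u v → adj matching u v ≡ true → end u ≡ partner (end v)
  adjacent⇒partner u v adjacent with end u ≟ᴱ partner (end v)
  ... | yes eq = eq
  ... | no _ = contradiction adjacent λ ()

  aut-partner : (σ : Aut matching) → ∀ e → end (to σ (vertex (partner e))) ≡ partner (end (to σ (vertex e)))
  aut-partner σ e = partner-swap (adjacent⇒partner _ _ adjacent)
    where
    ends : end (vertex e) ≡ partner (end (vertex (partner e)))
    ends = trans (end-vertex e)
      (sym (trans (cong partner (end-vertex (partner e))) (partner-involutive e)))
    adjacent : adj matching (to σ (vertex e)) (to σ (vertex (partner e))) ≡ true
    adjacent = trans (preserve σ (vertex e) (vertex (partner e))) (dec-true (_ ≟ᴱ _) ends)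

  fixes-false-sides⇒identity : (σ : Aut matching) → (∀ j → to σ (vertex (j , false)) ≡ vertex (j , false)) →
    IsIdentity σ
  fixes-false-sides⇒identity σ fixes = on-ends fixes-ends
    where
    open ≡-Reasoning
    fixes-ends : ∀ e → to σ (vertex e) ≡ vertex e
    fixes-ends (j , false) = fixes j
    fixes-ends (j , true) = begin
      to σ (vertex (partner (j , false)))                ≡⟨ vertex-end _ ⟨
      vertex (end (to σ (vertex (partner (j , false))))) ≡⟨ cong vertex (aut-partner σ (j , false)) ⟩
      vertex (partner (end (to σ (vertex (j , false))))) ≡⟨ cong (vertex ∘ partner ∘ end) (fixes j) ⟩
      vertex (partner (end (vertex (j , false))))        ≡⟨ cong (vertex ∘ partner) (end-vertex (j , false)) ⟩
      vertex (j , true)                                  ∎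

  module _ (τ τ⁻¹ : End → End) (τ⁻¹∘τ : ∀ e → τ⁻¹ (τ e) ≡ e) (τ∘τ⁻¹ : ∀ e → τ (τ⁻¹ e) ≡ e)
           (τ-partner : ∀ e → τ (partner e) ≡ partner (τ e)) where

    endAut : Aut matching
    endAut = record
      { to = vertex ∘ τ ∘ end
      ; from = vertex ∘ τ⁻¹ ∘ end
      ; to-from = λ v → trans (cong (vertex ∘ τ) (end-vertex _)) (trans (cong vertex (τ∘τ⁻¹ _)) (vertex-end v))
      ; from-to = λ v → trans (cong (vertex ∘ τ⁻¹) (end-vertex _)) (trans (cong vertex (τ⁻¹∘τ _)) (vertex-end v))
      ; preserve = λ u v →
          trans (cong₂ (λ x y → does (x ≟ᴱ partner y)) (end-vertex (τ (end u))) (end-vertex (τ (end v))))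
                (does-≡ (τ (end u) ≟ᴱ partner (τ (end v))) (map′ τ-preserves τ-reflects (end u ≟ᴱ partner (end v))))
      }
      where
      τ-preserves : ∀ {x y} → x ≡ partner y → τ x ≡ partner (τ y)
      τ-preserves {y = y} x≡py = trans (cong τ x≡py) (τ-partner y)
      τ-reflects : ∀ {x y} → τ x ≡ partner (τ y) → x ≡ partner y
      τ-reflects {x} {y} eq =
        trans (sym (τ⁻¹∘τ x)) (trans (cong τ⁻¹ (trans eq (sym (τ-partner y)))) (τ⁻¹∘τ (partner y)))

  wreath : Permutation′ m → (Fin m → Bool) → End → End
  wreath π φ (j , b) = π ⟨$⟩ʳ j , b xor φ j

  wreath⁻¹ : Permutation′ m → (Fin m → Bool) → End → End
  wreath⁻¹ π φ (j , b) = π ⟨$⟩ˡ j , b xor φ (π ⟨$⟩ˡ j)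

  wreathAut : Permutation′ m → (Fin m → Bool) → Aut matching
  wreathAut π φ = endAut (wreath π φ) (wreath⁻¹ π φ) inverse₁ inverse₂ commutes
    where
    inverse₁ : ∀ e → wreath⁻¹ π φ (wreath π φ e) ≡ e
    inverse₁ (j , b) rewrite inverseˡ π {j} = cong (j ,_) (xor-cancelʳ b (φ j))
    inverse₂ : ∀ e → wreath π φ (wreath⁻¹ π φ e) ≡ e
    inverse₂ (j , b) = cong₂ _,_ (inverseʳ π) (xor-cancelʳ b _)
    commutes : ∀ e → wreath π φ (partner e) ≡ partner (wreath π φ e)
    commutes (j , b) = cong (π ⟨$⟩ʳ j ,_) (sym (not-distribˡ-xor b (φ j)))

  wreathAut-vertex : ∀ π φ e → to (wreathAut π φ) (vertex e) ≡ vertex (wreath π φ e)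
  wreathAut-vertex π φ e = cong (vertex ∘ wreath π φ) (end-vertex e)

  wreathAut-¬identity : ∀ π φ e → wreath π φ e ≢ e → ¬ IsIdentity (wreathAut π φ)
  wreathAut-¬identity π φ e moves id =
    moves (vertex-injective (trans (sym (wreathAut-vertex π φ e)) (id (vertex e))))

  atEdge : Fin m → Fin m → Bool
  atEdge j j′ = does (j′ ≟ j)

  flipEdge : Fin m → Aut matching
  flipEdge j = wreathAut Perm.id (atEdge j)

  flipEdge-fixes-other-edges : ∀ {j j′} b → j′ ≢ j → to (flipEdge j) (vertex (j′ , b)) ≡ vertex (j′ , b)
  flipEdge-fixes-other-edges {j} {j′} b j′≢j = begin
    to (flipEdge j) (vertex (j′ , b))     ≡⟨ wreathAut-vertex Perm.id (atEdge j) (j′ , b) ⟩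
    vertex (j′ , b xor does (j′ ≟ j))     ≡⟨ cong (λ x → vertex (j′ , b xor x)) (dec-false (j′ ≟ j) j′≢j) ⟩
    vertex (j′ , b xor false)             ≡⟨ cong (vertex ∘ (j′ ,_)) (xor-identityʳ b) ⟩
    vertex (j′ , b)                       ∎
    where open ≡-Reasoning

  flipEdge-¬identity : ∀ j → ¬ IsIdentity (flipEdge j)
  flipEdge-¬identity j = wreathAut-¬identity Perm.id (atEdge j) (j , false) moves
    where
    moves : (j , does (j ≟ j)) ≢ (j , false)
    moves eq with trans (sym (dec-true (j ≟ j) refl)) (cong proj₂ eq)
    ... | ()

  determining-covers : (S : Subset (m + m)) → Determining matching S → Covers S
  determining-covers S det j with vertex (j , false) ∈? S | vertex (j , true) ∈? S
  ... | yes l∈S | _ = inj₁ l∈S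
  ... | no _ | yes r∈S = inj₂ r∈S
  ... | no l∉S | no r∉S = contradiction (det (flipEdge j) (on-ends fixes)) (flipEdge-¬identity j)
    where
    fixes : ∀ e → vertex e ∈ S → to (flipEdge j) (vertex e) ≡ vertex e
    fixes (j′ , b) e∈S with j′ ≟ j
    fixes (_ , false) e∈S | yes refl = contradiction e∈S l∉S
    fixes (_ , true) e∈S | yes refl = contradiction e∈S r∉S
    fixes (_ , b) e∈S | no j′≢j = flipEdge-fixes-other-edges b j′≢j

  determining⇒m≤∣S∣ : (S : Subset (m + m)) → Determining matching S → m ≤ ∣ S ∣
  determining⇒m≤∣S∣ S det = covers⇒m≤∣S∣ S (determining-covers S det)

  separated⇒distinguishing : ∀ {d} (κ : End → Fin d) →
    (∀ j j′ → κ (j , false) ≢ κ (j′ , true)) →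
    (∀ {j j′} → κ (j , false) ≡ κ (j′ , false) → κ (j , true) ≡ κ (j′ , true) → j ≡ j′) →
    Distinguishing matching d (κ ∘ end)
  separated⇒distinguishing κ disjoint pairs-injective σ preserves =
    fixes-false-sides⇒identity σ fixes
    where
    image : ∀ {e e′} → end (to σ (vertex e)) ≡ e′ → to σ (vertex e) ≡ vertex e′
    image eq = trans (sym (vertex-end _)) (cong vertex eq)

    same-colour : ∀ {e e′} → end (to σ (vertex e)) ≡ e′ → κ e′ ≡ κ e
    same-colour {e} eq = trans (cong κ (sym eq)) (trans (preserves (vertex e)) (cong κ (end-vertex e)))

    fixes : ∀ j → to σ (vertex (j , false)) ≡ vertex (j , false)
    fixes j with end (to σ (vertex (j , false))) in eq
    ... | j′ , true = contradiction (sym (same-colour {j , false} eq)) (disjoint j j′)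
    ... | j′ , false = trans (image {j , false} eq) (cong (λ x → vertex (x , false)) (sym j≡j′))
      where
      eq′ : end (to σ (vertex (j , true))) ≡ (j′ , true)
      eq′ = trans (aut-partner σ (j , false)) (cong partner eq)
      j≡j′ : j ≡ j′
      j≡j′ = pairs-injective (sym (same-colour {j , false} eq)) (sym (same-colour {j , true} eq′))

  orientedColour : ∀ {d} → (Fin (m + m) → Fin d) → (Fin m → Bool) → Fin m → Bool → Fin d
  orientedColour c s j b = c (vertex (j , b xor s j))

  reorientation : Permutation′ m → (Fin m → Bool) → Fin m → Bool
  reorientation π s j = s j xor s (π ⟨$⟩ʳ j)

  reorient : Permutation′ m → (Fin m → Bool) → Aut matching
  reorient π s = wreathAut π (reorientation π s)

  reorient-preserves : ∀ {d} π s (c : Fin (m + m) → Fin d) →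
    (∀ j b → orientedColour c s (π ⟨$⟩ʳ j) b ≡ orientedColour c s j b) →
    ∀ v → c (to (reorient π s) v) ≡ c v
  reorient-preserves π s c invariant = on-ends preserves
    where
    open ≡-Reasoning
    preserves : ∀ e → c (to (reorient π s) (vertex e)) ≡ c (vertex e)
    preserves (j , b) = begin
      c (to (reorient π s) (vertex (j , b)))      ≡⟨ cong c (wreathAut-vertex π (reorientation π s) (j , b)) ⟩
      c (vertex (π ⟨$⟩ʳ j , b xor s j xor s (π ⟨$⟩ʳ j)))
        ≡⟨ cong (λ x → c (vertex (π ⟨$⟩ʳ j , x))) (sym (xor-assoc b (s j) _)) ⟩
      orientedColour c s (π ⟨$⟩ʳ j) (b xor s j)   ≡⟨ invariant j (b xor s j) ⟩
      orientedColour c s j (b xor s j)            ≡⟨ cong (λ x → c (vertex (j , x))) (xor-cancelʳ b (s j)) ⟩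
      c (vertex (j , b))                          ∎

  module _ {d} {c : Fin (m + m) → Fin d} (dist : Distinguishing matching d c) {i : Fin d}
           (cheap : classComplementSize c i ≤ m) where

    private
      covers : Covers (outsideClass c i)
      covers = determining-covers _ (outsideClass-determining matching dist i)

    oneEndColoured : ∀ j → Σ Bool λ b → c (vertex (j , b)) ≢ i × c (vertex (j , not b)) ≡ i
    oneEndColoured j with c (vertex (j , false)) ≟ i | c (vertex (j , true)) ≟ i
    ... | yes f≡i | no t≢i = true , t≢i , f≡i
    ... | no f≢i | yes t≡i = false , f≢i , t≡i
    ... | yes f≡i | yes t≡i =
      contradiction (covers j) [ (λ l → outsideClass⁻ c i l f≡i) , (λ r → outsideClass⁻ c i r t≡i) ]′
    ... | no f≢i | no t≢i = contradiction
      (covers⇒m<∣S∣ _ covers j (outsideClass⁺ c i f≢i) (outsideClass⁺ c i t≢i))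
      (≤⇒≯ (subst (_≤ m) (classComplementSize≡∣outsideClass∣ c i) cheap))

    private
      s : Fin m → Bool
      s j = proj₁ (oneEndColoured j)

      κ : Fin m → Fin d
      κ j = c (vertex (j , s j))

      orientedColour-invariant : ∀ {j j′} → κ j ≡ κ j′ → ∀ b → orientedColour c s j b ≡ orientedColour c s j′ b
      orientedColour-invariant κj≡κj′ false = κj≡κj′
      orientedColour-invariant {j} {j′} _ true =
        trans (proj₂ (proj₂ (oneEndColoured j))) (sym (proj₂ (proj₂ (oneEndColoured j′))))

      distinct-edges-distinct-colours : ∀ {j j′} → j ≢ j′ → κ j ≢ κ j′
      distinct-edges-distinct-colours {j} {j′} j≢j′ κj≡κj′ =
        wreathAut-¬identity π (reorientation π s) (j , false) moves (dist (reorient π s) preserves)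
        where
        π : Permutation′ m
        π = transpose j j′
        preserves : ∀ v → c (to (reorient π s) v) ≡ c v
        preserves = reorient-preserves π s c λ k b →
          transpose-invariant (λ k → orientedColour c s k b) (orientedColour-invariant κj≡κj′ b) k
        moves : wreath π (reorientation π s) (j , false) ≢ (j , false)
        moves eq = j≢j′ (trans (sym (cong proj₁ eq)) (transpose-sends j j′))

      withColour : Fin (suc m) → Fin d
      withColour zero = i
      withColour (suc j) = κ j

    -- The m colours κ j of the uncoloured ends, together with i, are pairwise distinct.
    cheap⇒m<d : m < d
    cheap⇒m<d = ≰⇒> λ d≤m → collision (pigeonhole (s≤s d≤m) withColour)
      where
      collision : ¬ ∃₂ λ a b → a Fin.< b × withColour a ≡ withColour b
      collision (zero , suc j , _ , i≡κj) = proj₁ (proj₂ (oneEndColoured j)) (sym i≡κj)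
      collision (suc j , suc j′ , j<j′ , κj≡κj′) =
        distinct-edges-distinct-colours (<⇒≢ (s<s⁻¹ j<j′)) κj≡κj′

  falseSides : Subset (m + m)
  falseSides = ⊤ {m} ++ ⊥ {m}

  falseSides-determining : Determining matching falseSides
  falseSides-determining σ fixes = fixes-false-sides⇒identity σ λ j → fixes _ (∈-++⁺ˡ (⊤ {m}) (⊥ {m}) ∈⊤)

  ∣falseSides∣≡m : ∣ falseSides ∣ ≡ m
  ∣falseSides∣≡m =
    trans (∣p++q∣≡∣p∣+∣q∣ (⊤ {m}) (⊥ {m})) (trans (cong₂ _+_ (∣⊤∣≡n m) (∣⊥∣≡0 m)) (+-identityʳ m))

  matching-det : IsDet matching m
  matching-det = (falseSides , falseSides-determining , ∣falseSides∣≡m) ,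
                 λ { _ (S , det , refl) → ≤⇒≯ (determining⇒m≤∣S∣ S det) }

  distinguishing⇒m≤classComplementSize : ∀ {d} {c : Fin (m + m) → Fin d} → Distinguishing matching d c →
    ∀ i → m ≤ classComplementSize c i
  distinguishing⇒m≤classComplementSize {c = c} dist i =
    subst (m ≤_) (sym (classComplementSize≡∣outsideClass∣ c i))
      (determining⇒m≤∣S∣ _ (outsideClass-determining matching dist i))

  frugalColour : End → Fin (suc m)
  frugalColour (j , false) = suc j
  frugalColour (j , true) = zero

  frugal-distinguishing : Distinguishing matching (suc m) (frugalColour ∘ end)
  frugal-distinguishing = separated⇒distinguishing frugalColour (λ _ _ ()) (λ eq _ → suc-injective eq)

  outsideZero⊆falseSides : outsideClass (frugalColour ∘ end) zero ⊆ falseSides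
  outsideZero⊆falseSides {v} = on-ends {P} onFalse v
    where
    P : Fin (m + m) → Set
    P v = v ∈ outsideClass (frugalColour ∘ end) zero → v ∈ falseSides
    onFalse : ∀ e → vertex e ∈ outsideClass (frugalColour ∘ end) zero → vertex e ∈ falseSides
    onFalse (j , false) _ = ∈-++⁺ˡ (⊤ {m}) (⊥ {m}) ∈⊤
    onFalse (j , true) v∈ =
      contradiction (cong frugalColour (end-vertex (j , true))) (outsideClass⁻ (frugalColour ∘ end) zero v∈)

  frugal-classComplementSize : classComplementSize (frugalColour ∘ end) zero ≡ m
  frugal-classComplementSize = ≤-antisym
    (begin
      classComplementSize (frugalColour ∘ end) zero ≡⟨ classComplementSize≡∣outsideClass∣ (frugalColour ∘ end) zero ⟩
      ∣ outsideClass (frugalColour ∘ end) zero ∣    ≤⟨ p⊆q⇒∣p∣≤∣q∣ outsideZero⊆falseSides ⟩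
      ∣ falseSides ∣                                ≡⟨ ∣falseSides∣≡m ⟩
      m                                             ∎)
    (distinguishing⇒m≤classComplementSize frugal-distinguishing zero)
    where open ≤-Reasoning

  matching-paintCost : IsPaintCost matching (suc m) m
  matching-paintCost =
    (frugalColour ∘ end , frugal-distinguishing , zero , frugal-classComplementSize) ,
    λ { _ (c , dist , i , refl) → ≤⇒≯ (distinguishing⇒m≤classComplementSize dist i) }

  matching-distf : IsDistf matching (suc m)
  matching-distf = (m , matching-paintCost , matching-det) , fewer-colours-cost-more
    where
    fewer-colours-cost-more : ∀ d → d < suc m → ¬ ∃ λ m₀ → IsPaintCost matching d m₀ × IsDet matching m₀
    fewer-colours-cost-more d d<1+m (m₀ , ((c , dist , i , refl) , _) , (_ , det-minimal)) =
      <⇒≱ (cheap⇒m<d dist cheap) (s≤s⁻¹ d<1+m)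
      where
      cheap : classComplementSize c i ≤ m
      cheap = ≮⇒≥ (det-minimal m (falseSides , falseSides-determining , ∣falseSides∣≡m))

module _ (s : ℕ) where
  open Matching (s * s)

  digitColour : End → Fin (s + s)
  digitColour (j , false) = quotient s j ↑ˡ s
  digitColour (j , true) = s ↑ʳ remainder {s} s j

  digitColour-distinguishing : Distinguishing matching (s + s) (digitColour ∘ end)
  digitColour-distinguishing = separated⇒distinguishing digitColour
    (λ j j′ → ↑ˡ≢↑ʳ (quotient s j) (remainder {s} s j′))
    (λ q≡q′ r≡r′ → remQuot-injective s (×-≡,≡→≡ (↑ˡ-injective s _ _ q≡q′ , ↑ʳ-injective s _ _ r≡r′)))

n*2s<s*s : ∀ n {a} s .{{_ : NonZero s}} → a ≤ s + s → n + n < s → n * a < s * s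
n*2s<s*s n {a} s a≤2s 2n<s = begin-strict
  n * a         ≤⟨ *-monoʳ-≤ n a≤2s ⟩
  n * (s + s)   ≡⟨ *-distribˡ-+ n s s ⟩
  n * s + n * s ≡⟨ *-distribʳ-+ s n n ⟨
  (n + n) * s   <⟨ *-monoˡ-< s 2n<s ⟩
  s * s         ∎
  where open ≤-Reasoning

mainTheorem6 : (n : ℕ) → 0 < n → (bound : ℕ) →
    Σ ℕ λ k → bound < k × Σ (Graph k) λ G →
    Σ ℕ λ a → Σ ℕ λ b → IsDist G a × IsDistf G b × n * a < b
mainTheorem6 n _ bound =
  let a , isDist , a≤2s = IsDist-≤ matching (digitColour s ∘ end , digitColour-distinguishing s)
  in m + m , bound<2m , matching , a , suc m , isDist , matching-distf , m<n⇒m<1+n (n*2s<s*s n s a≤2s 2n<s)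
  where
  s m : ℕ
  s = suc (bound + (n + n))
  m = s * s
  open Matching m using (matching; end; matching-distf)

  2n<s : n + n < s
  2n<s = s≤s (m≤n+m (n + n) bound)

  bound<2m : bound < m + m
  bound<2m = ≤-trans (s≤s (m≤m+n bound (n + n))) (≤-trans (m≤m*n s s) (m≤m+n m m))
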